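{- In continued conjunctive compound Node-Kayles under normal play, the set $\mathcal{L}$ of integers $m\ge 0$ such that the single path $P_m$ is a $\mathcal{P}$-position is $$\mathcal{L}=\{5(2^n-1):\ n\ge 0\}\cup\{5(2^{n+1}-1)-1:\ n\ge 0\}.$$
   Context: For $n\ge 0$, $P_n$ denotes the path on $n$ vertices ($P_0$ is the empty graph). A Node-Kayles move on a path $P_k$ with $k\ge 1$ chooses a vertex and deletes it together with its neighbours. The possible results are: $P_0$ if $k\in\{1,2\}$; $P_0$ or $P_1$ if $k=3$; and, for $k\ge 4$, $P_{k-2}$, $P_{k-3}$, or two paths $P_i,P_j$ with $j\ge i\ge1$, $i+j=k-3$. Continued conjunctive compound Node-Kayles is played by two players who move alternately, starting from a single path. A position is a finite multiset of paths (components). A move replaces every nonempty component simultaneously by the result of a Node-Kayles move on it; a split component yields two components. The game ends when all components are empty (long ending rule). Under normal play, the player who made the last move wins. A position is a $\mathcal{P}$-position if the second player (the one not moving next) has a winning strategy, and an $\mathcal{N}$-position otherwise. In particular, $P_0$ is a $\mathcal{P}$-position. -}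

module Defs where

open import Data.Nat using (ℕ; zero; suc; _+_; _*_; _∸_; _^_; _≤_)
open import Data.List using (List; []; _∷_; _++_)
open import Data.List.Relation.Unary.Any using (Any)
open import Data.Product using (_×_; ∃-syntax)
open import Data.Sum using (_⊎_)
open import Relation.Binary.PropositionalEquality using (_≡_)

-- A path P_k is represented by the natural number k (P_0 = empty graph).
-- A position is a finite multiset of components, represented by a list
-- (order is irrelevant for the game; empty components P_0 may occur).

data NKMove : ℕ → List ℕ → Set where
  one    : NKMove 1 (0 ∷ [])
  two    : NKMove 2 (0 ∷ [])
  three0 : NKMove 3 (0 ∷ [])
  three1 : NKMove 3 (1 ∷ [])
  end2   : ∀ k → NKMove (4 + k) ((2 + k) ∷ [])
  end3   : ∀ k → NKMove (4 + k) ((1 + k) ∷ [])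
  -- k = 4 + k'  :  P_i , P_j  with 1 ≤ i ≤ j, i + j = k - 3
  split  : ∀ k i j → 1 ≤ i → i ≤ j → i + j ≡ 1 + k →
           NKMove (4 + k) (i ∷ j ∷ [])

data ConjMove : List ℕ → List ℕ → Set where
  nil   : ConjMove [] []
  skip0 : ∀ {ps qs} → ConjMove ps qs → ConjMove (0 ∷ ps) qs
  play  : ∀ {k r ps qs} → NKMove (suc k) r → ConjMove ps qs →
          ConjMove (suc k ∷ ps) (r ++ qs)

-- A legal move requires at least one nonempty component
-- (the game ends when all components are empty).
Step : List ℕ → List ℕ → Set
Step ps qs = ConjMove ps qs × Any (λ k → 1 ≤ k) ps

-- Outcome classes under normal play (last mover wins), defined as the
-- least fixed point (the game is finite):
--   P : every move leads to an N-position (in particular terminal positions);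
--   N : some move leads to a P-position.
data IsP : List ℕ → Set
data IsN : List ℕ → Set

data IsP where
  allToN : ∀ {ps} → (∀ qs → Step ps qs → IsN qs) → IsP ps

data IsN where
  someToP : ∀ {ps qs} → Step ps qs → IsP qs → IsN ps

InL : ℕ → Set
InL m = (∃[ n ] m ≡ 5 * (2 ^ n ∸ 1)) ⊎ (∃[ n ] m ≡ 5 * (2 ^ (n + 1) ∸ 1) ∸ 1)

-- In a continued conjunctive compound the outcome is governed by the largest
-- suspense among the components.  If that maximum E is even, every move
-- lowers it to exactly E - 1; if E is odd, some move lowers it to E - 1.  So
-- a position is a P-position exactly when E is even.  For a single path the
-- suspense is explicit: with a n = 5(2^n - 1), a path P_k in the band
-- a n < k ≤ a (n + 1) has suspense 2n + 2 if k is one of the last two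
-- lengths of the band and 2n + 1 otherwise.  The even values occur exactly
-- at the lengths listed in L.

module Submission where

open import Defs
open import Data.Nat using (ℕ)
open import Data.List using (List; []; _∷_)
open import Function.Bundles using (_⇔_)

open import Data.Nat using (zero; suc; pred; _+_; _*_; _∸_; _^_; _⊔_; _≤_; _<_; _≤?_; _<?_; z≤n; s≤s)
open import Data.Nat.Properties
open import Data.Nat.Induction using (<-wellFounded)
open import Data.Nat.ListAction using (sum)
open import Data.Nat.ListAction.Properties using (sum-++)
open import Data.Nat.Tactic.RingSolver using (solve-∀)
open import Data.Bool using (Bool; true; false; not)
open import Data.Bool.Properties using (not-involutive)
open import Data.List using (_++_)
open import Data.List.Relation.Unary.Any using (Any; here; there)
open import Data.List.Membership.Propositional using (_∈_)
open import Data.Product using (_×_; _,_; proj₁; proj₂; ∃-syntax)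
open import Data.Sum using (_⊎_; inj₁; inj₂)
open import Data.Empty using (⊥; ⊥-elim)
open import Function.Bundles using (mk⇔)
open import Function.Properties.Equivalence using () renaming (trans to ⇔-trans)
open import Induction.WellFounded using (Acc; acc)
open import Relation.Nullary using (yes; no)
open import Relation.Binary.PropositionalEquality

double-mono : ∀ {m n} → m ≤ n → m + m ≤ n + n
double-mono m≤n = +-mono-≤ m≤n m≤n

half-< : ∀ {m n} → suc (m + m) ≤ n + n → m < n
half-< {m} {n} 1+2m≤2n with m <? n
... | yes m<n = m<n
... | no m≮n = ⊥-elim (<⇒≱ 1+2m≤2n (double-mono (≮⇒≥ m≮n)))

even : ℕ → Bool
even zero = true
even (suc n) = not (even n)

even-double : ∀ n → even (n + n) ≡ true
even-double zero = refl
even-double (suc n)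
  rewrite +-suc n n | not-involutive (even (n + n)) = even-double n

even-suc-double : ∀ n → even (suc (n + n)) ≡ false
even-suc-double n = cong not (even-double n)

even-2+double : ∀ n → even (2 + (n + n)) ≡ true
even-2+double n = trans (not-involutive (even (n + n))) (even-double n)

false≢true : false ≢ true
false≢true ()

even-pred : ∀ {n} → n ≢ 0 → even (pred n) ≡ not (even n)
even-pred {zero} n≢0 = ⊥-elim (n≢0 refl)
even-pred {suc n} _ = sym (not-involutive (even n))

maxBy : (ℕ → ℕ) → List ℕ → ℕ
maxBy σ [] = 0
maxBy σ (k ∷ ks) = σ k ⊔ maxBy σ ks

module _ (σ : ℕ → ℕ) where

  maxBy-++ : ∀ xs ys → maxBy σ (xs ++ ys) ≡ maxBy σ xs ⊔ maxBy σ ys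
  maxBy-++ [] ys = refl
  maxBy-++ (x ∷ xs) ys rewrite maxBy-++ xs ys = sym (⊔-assoc (σ x) (maxBy σ xs) (maxBy σ ys))

  ≤-maxBy : ∀ {k ks} → k ∈ ks → σ k ≤ maxBy σ ks
  ≤-maxBy {ks = k ∷ ks} (here refl) = m≤m⊔n (σ k) (maxBy σ ks)
  ≤-maxBy {ks = k ∷ ks} (there k∈ks) = ≤-trans (≤-maxBy k∈ks) (m≤n⊔m (σ k) (maxBy σ ks))

  maxBy-≤ : ∀ {b} ks → (∀ {k} → k ∈ ks → σ k ≤ b) → maxBy σ ks ≤ b
  maxBy-≤ [] _ = z≤n
  maxBy-≤ (k ∷ ks) bound = ⊔-lub (bound (here refl)) (maxBy-≤ ks (λ k∈ks → bound (there k∈ks)))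

  maxBy-attained : ∀ ks → maxBy σ ks ≡ 0 ⊎ ∃[ k ] k ∈ ks × σ k ≡ maxBy σ ks
  maxBy-attained [] = inj₁ refl
  maxBy-attained (k ∷ ks) with ⊔-sel (σ k) (maxBy σ ks)
  ... | inj₁ σk = inj₂ (k , here refl , sym σk)
  ... | inj₂ rest with maxBy-attained ks
  ...   | inj₁ none = inj₁ (trans rest none)
  ...   | inj₂ (k′ , k′∈ks , σk′) = inj₂ (k′ , there k′∈ks , trans σk′ (sym rest))

  maxBy-largest : (∀ {i j} → i ≤ j → σ i ≤ σ j) → ∀ {j ks} → j ∈ ks →
                  (∀ {i} → i ∈ ks → i ≤ j) → maxBy σ ks ≡ σ j
  maxBy-largest mono {ks = ks} j∈ks largest =
    ≤-antisym (maxBy-≤ ks (λ i∈ks → mono (largest i∈ks))) (≤-maxBy j∈ks)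

∈⇒≤sum : ∀ {i ks} → i ∈ ks → i ≤ sum ks
∈⇒≤sum {ks = k ∷ ks} (here refl) = m≤m+n k (sum ks)
∈⇒≤sum {ks = k ∷ ks} (there i∈ks) = ≤-trans (∈⇒≤sum i∈ks) (m≤n+m (sum ks) k)

nk-sum< : ∀ {k r} → NKMove k r → sum r < k
nk-sum< one = s≤s z≤n
nk-sum< two = s≤s z≤n
nk-sum< three0 = s≤s z≤n
nk-sum< three1 = s≤s (s≤s z≤n)
nk-sum< (end2 k) rewrite +-identityʳ k = n≤1+n (3 + k)
nk-sum< (end3 k) rewrite +-identityʳ k = m≤n+m (2 + k) 2
nk-sum< (split k i j _ _ i+j≡1+k) rewrite +-identityʳ j | i+j≡1+k = m≤n+m (2 + k) 2

nk-part< : ∀ {k r i} → NKMove k r → i ∈ r → i < k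
nk-part< move i∈r = ≤-<-trans (∈⇒≤sum i∈r) (nk-sum< move)

nk-some-move : ∀ k → ∃[ r ] NKMove (suc k) r
nk-some-move zero = _ , one
nk-some-move (suc zero) = _ , two
nk-some-move (suc (suc zero)) = _ , three0
nk-some-move (suc (suc (suc k))) = _ , end2 k

nk-largest-part : ∀ {k r} → NKMove k r → 4 ≤ k →
                  ∃[ j ] j ∈ r × (∀ {i} → i ∈ r → i ≤ j) × k ≤ 3 + (j + j) × 2 + j ≤ k
nk-largest-part one (s≤s ())
nk-largest-part two (s≤s (s≤s ()))
nk-largest-part three0 (s≤s (s≤s (s≤s ())))
nk-largest-part three1 (s≤s (s≤s (s≤s ())))
nk-largest-part (end2 k) _ =
  2 + k , here refl , (λ { (here refl) → ≤-refl }) ,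
  +-monoʳ-≤ 3 (≤-trans (n≤1+n (1 + k)) (m≤m+n (2 + k) (2 + k))) , ≤-refl
nk-largest-part (end3 k) _ =
  1 + k , here refl , (λ { (here refl) → ≤-refl }) ,
  +-monoʳ-≤ 3 (m≤m+n (1 + k) (1 + k)) , n≤1+n (3 + k)
nk-largest-part (split k i j _ i≤j i+j≡1+k) _ =
  j , there (here refl) , (λ { (here refl) → i≤j ; (there (here refl)) → ≤-refl }) ,
  +-monoʳ-≤ 3 (subst (_≤ j + j) i+j≡1+k (+-monoˡ-≤ j i≤j)) ,
  +-monoʳ-≤ 2 (≤-trans (subst (j ≤_) i+j≡1+k (m≤n+m j i)) (n≤1+n (1 + k)))

maxBy-option-≤ : ∀ (σ : ℕ → ℕ) → (∀ {i j} → i ≤ j → σ i ≤ σ j) →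
                 ∀ {k r} → NKMove k r → maxBy σ r ≤ σ k
maxBy-option-≤ σ mono {r = r} move = maxBy-≤ σ r (λ i∈r → mono (<⇒≤ (nk-part< move i∈r)))

conj-sum≤ : ∀ {ps qs} → ConjMove ps qs → sum qs ≤ sum ps
conj-sum≤ nil = z≤n
conj-sum≤ (skip0 c) = conj-sum≤ c
conj-sum≤ (play {r = r} {qs = qs} move c)
  rewrite sum-++ r qs = +-mono-≤ (<⇒≤ (nk-sum< move)) (conj-sum≤ c)

conj-sum< : ∀ {ps qs} → ConjMove ps qs → Any (1 ≤_) ps → sum qs < sum ps
conj-sum< (skip0 c) (there nonempty) = conj-sum< c nonempty
conj-sum< (play {r = r} {qs = qs} move c) (here _)
  rewrite sum-++ r qs = +-mono-<-≤ (nk-sum< move) (conj-sum≤ c)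
conj-sum< (play {r = r} {qs = qs} move c) (there nonempty)
  rewrite sum-++ r qs = +-mono-≤-< (<⇒≤ (nk-sum< move)) (conj-sum< c nonempty)

P∧N⇒⊥ : ∀ {ps} → IsP ps → IsN ps → ⊥
P∧N⇒⊥ (allToN toN) (someToP step p) = P∧N⇒⊥ p (toN _ step)

-- Outcomes from a suspense function on paths

module MaxSuspense
  (σ : ℕ → ℕ)
  (σ-zero : σ 0 ≡ 0)
  (option-≤ : ∀ {k r} → NKMove k r → maxBy σ r ≤ σ k)
  (even-option : ∀ {k r} → even (σ k) ≡ true → NKMove k r → suc (maxBy σ r) ≡ σ k)
  (pred-option : ∀ k → ∃[ r ] NKMove (suc k) r × suc (maxBy σ r) ≡ σ (suc k))
  where

  σ-suc≢0 : ∀ k → σ (suc k) ≢ 0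
  σ-suc≢0 k σ≡0 with pred-option k
  ... | _ , _ , eq = 1+n≢0 (trans eq σ≡0)

  nonempty⇒maxBy≢0 : ∀ {ps} → Any (1 ≤_) ps → maxBy σ ps ≢ 0
  nonempty⇒maxBy≢0 {suc k ∷ ps} (here _) max≡0 =
    σ-suc≢0 k (n≤0⇒n≡0 (subst (σ (suc k) ≤_) max≡0 (m≤m⊔n (σ (suc k)) (maxBy σ ps))))
  nonempty⇒maxBy≢0 {k ∷ ps} (there nonempty) max≡0 =
    nonempty⇒maxBy≢0 nonempty (n≤0⇒n≡0 (subst (maxBy σ ps ≤_) max≡0 (m≤n⊔m (σ k) (maxBy σ ps))))

  maxBy≢0⇒nonempty : ∀ ps → maxBy σ ps ≢ 0 → Any (1 ≤_) ps
  maxBy≢0⇒nonempty [] max≢0 = ⊥-elim (max≢0 refl)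
  maxBy≢0⇒nonempty (zero ∷ ps) max≢0 =
    there (maxBy≢0⇒nonempty ps (λ max≡0 → max≢0 (trans (cong (_⊔ maxBy σ ps) σ-zero) max≡0)))
  maxBy≢0⇒nonempty (suc k ∷ ps) _ = here (s≤s z≤n)

  option-≤-pred : ∀ {E k r} → even E ≡ true → σ k ≤ E → NKMove k r → maxBy σ r ≤ pred E
  option-≤-pred {E} {k} evenE σk≤E move with even (σ k) in parity
  ... | true = subst (_≤ pred E) (sym (cong pred (even-option parity move))) (pred-mono-≤ σk≤E)
  ... | false = ≤-trans (option-≤ move) (<⇒≤pred (≤∧≢⇒< σk≤E σk≢E))
    where
    σk≢E : σ k ≢ E
    σk≢E σk≡E = false≢true (trans (sym parity) (trans (cong even σk≡E) evenE))

  after-even-≤ : ∀ {E ps qs} → even E ≡ true → maxBy σ ps ≤ E → ConjMove ps qs →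
                 maxBy σ qs ≤ pred E
  after-even-≤ _ _ nil = z≤n
  after-even-≤ {ps = zero ∷ ps} evenE bound (skip0 c) =
    after-even-≤ evenE (≤-trans (m≤n⊔m (σ 0) (maxBy σ ps)) bound) c
  after-even-≤ {ps = suc k ∷ ps} evenE bound (play {r = r} {qs = qs} move c)
    rewrite maxBy-++ σ r qs =
    ⊔-lub (option-≤-pred evenE (≤-trans (m≤m⊔n (σ (suc k)) (maxBy σ ps)) bound) move)
          (after-even-≤ evenE (≤-trans (m≤n⊔m (σ (suc k)) (maxBy σ ps)) bound) c)

  after-even-≥ : ∀ {k ps qs} → ConjMove ps qs → k ∈ ps → even (σ k) ≡ true →
                 pred (σ k) ≤ maxBy σ qs
  after-even-≥ (skip0 c) (here refl) _ rewrite σ-zero = z≤n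
  after-even-≥ (skip0 c) (there k∈ps) evenσk = after-even-≥ c k∈ps evenσk
  after-even-≥ (play {r = r} {qs = qs} move c) (here refl) evenσk
    rewrite maxBy-++ σ r qs | sym (even-option evenσk move) = m≤m⊔n (maxBy σ r) (maxBy σ qs)
  after-even-≥ (play {r = r} {qs = qs} move c) (there k∈ps) evenσk
    rewrite maxBy-++ σ r qs = ≤-trans (after-even-≥ c k∈ps evenσk) (m≤n⊔m (maxBy σ r) (maxBy σ qs))

  move-from-even : ∀ {ps qs} → even (maxBy σ ps) ≡ true → ConjMove ps qs →
                   maxBy σ qs ≡ pred (maxBy σ ps)
  move-from-even {ps} evenE c with maxBy-attained σ ps
  ... | inj₁ max≡0 =
    ≤-antisym (after-even-≤ evenE ≤-refl c) (subst (λ e → pred e ≤ _) (sym max≡0) z≤n)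
  ... | inj₂ (k , k∈ps , σk≡E) = ≤-antisym (after-even-≤ evenE ≤-refl c)
    (subst (λ e → pred e ≤ _) σk≡E (after-even-≥ c k∈ps (trans (cong even σk≡E) evenE)))

  move-to-pred : ∀ ps → ∃[ qs ] ConjMove ps qs × maxBy σ qs ≡ pred (maxBy σ ps)
  move-to-pred [] = [] , nil , refl
  move-to-pred (zero ∷ ps) with move-to-pred ps
  ... | qs , c , eq = qs , skip0 c , trans eq (cong (λ s0 → pred (s0 ⊔ maxBy σ ps)) (sym σ-zero))
  move-to-pred (suc k ∷ ps) with move-to-pred ps | pred-option k
  ... | qs , c , eq | r , move , eqr = r ++ qs , play move c , (begin
    maxBy σ (r ++ qs)                       ≡⟨ maxBy-++ σ r qs ⟩
    maxBy σ r ⊔ maxBy σ qs                  ≡⟨ cong₂ _⊔_ (cong pred eqr) eq ⟩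
    pred (σ (suc k)) ⊔ pred (maxBy σ ps)    ≡⟨ mono-≤-distrib-⊔ pred-mono-≤ (σ (suc k)) (maxBy σ ps) ⟨
    pred (σ (suc k) ⊔ maxBy σ ps)           ∎)
    where open ≡-Reasoning

  outcome : ∀ ps → Acc _<_ (sum ps) →
            (even (maxBy σ ps) ≡ true → IsP ps) × (even (maxBy σ ps) ≡ false → IsN ps)
  outcome ps (acc smaller) = P-if-even , N-if-odd
    where
    P-if-even : even (maxBy σ ps) ≡ true → IsP ps
    P-if-even evenE = allToN λ qs (c , nonempty) →
      proj₂ (outcome qs (smaller (conj-sum< c nonempty)))
        (trans (cong even (move-from-even evenE c))
          (trans (even-pred (nonempty⇒maxBy≢0 nonempty)) (cong not evenE)))

    N-if-odd : even (maxBy σ ps) ≡ false → IsN ps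
    N-if-odd oddE with move-to-pred ps
    ... | qs , c , eq = someToP (c , nonempty)
      (proj₁ (outcome qs (smaller (conj-sum< c nonempty)))
        (trans (cong even eq) (trans (even-pred E≢0) (cong not oddE))))
      where
      E≢0 : maxBy σ ps ≢ 0
      E≢0 E≡0 = false≢true (trans (sym oddE) (cong even E≡0))
      nonempty : Any (1 ≤_) ps
      nonempty = maxBy≢0⇒nonempty ps E≢0

  isP⇔even-maxBy : ∀ ps → IsP ps ⇔ (even (maxBy σ ps) ≡ true)
  isP⇔even-maxBy ps = mk⇔ to (proj₁ (outcome ps (<-wellFounded (sum ps))))
    where
    to : IsP ps → even (maxBy σ ps) ≡ true
    to p with even (maxBy σ ps) in parity
    ... | true = refl
    ... | false = ⊥-elim (P∧N⇒⊥ p (proj₂ (outcome ps (<-wellFounded (sum ps))) parity))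

-- The suspense of a path

a : ℕ → ℕ
a zero = 0
a (suc n) = 5 + (a n + a n)

a-mono : ∀ {m n} → m ≤ n → a m ≤ a n
a-mono z≤n = z≤n
a-mono (s≤s m≤n) = +-monoʳ-≤ 5 (+-mono-≤ (a-mono m≤n) (a-mono m≤n))

5≤a-suc : ∀ n → 5 ≤ a (suc n)
5≤a-suc n = m≤m+n 5 (a n + a n)

a-cancel-< : ∀ {m n} → a m < a n → m < n
a-cancel-< {m} {n} am<an with m <? n
... | yes m<n = m<n
... | no m≮n = ⊥-elim (<⇒≱ am<an (a-mono (≮⇒≥ m≮n)))

a+5≡5*2^n : ∀ n → a n + 5 ≡ 5 * 2 ^ n
a+5≡5*2^n zero = refl
a+5≡5*2^n (suc n) = begin
  5 + (a n + a n) + 5     ≡⟨ regroup (a n) ⟩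
  (a n + 5) + (a n + 5)   ≡⟨ cong₂ _+_ (a+5≡5*2^n n) (a+5≡5*2^n n) ⟩
  5 * 2 ^ n + 5 * 2 ^ n   ≡⟨ *-distribˡ-+ 5 (2 ^ n) (2 ^ n) ⟨
  5 * (2 ^ n + 2 ^ n)     ≡⟨ cong (λ x → 5 * (2 ^ n + x)) (+-identityʳ (2 ^ n)) ⟨
  5 * 2 ^ suc n           ∎
  where
  open ≡-Reasoning
  regroup : ∀ x → 5 + (x + x) + 5 ≡ (x + 5) + (x + 5)
  regroup = solve-∀

a≡5*[2^n∸1] : ∀ n → a n ≡ 5 * (2 ^ n ∸ 1)
a≡5*[2^n∸1] n = begin
  a n                 ≡⟨ m+n∸n≡m (a n) 5 ⟨
  a n + 5 ∸ 5         ≡⟨ cong (_∸ 5) (a+5≡5*2^n n) ⟩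
  5 * 2 ^ n ∸ 5 * 1   ≡⟨ *-distribˡ-∸ 5 (2 ^ n) 1 ⟨
  5 * (2 ^ n ∸ 1)     ∎
  where open ≡-Reasoning

a-suc≡5*[2^[n+1]∸1] : ∀ n → a (suc n) ≡ 5 * (2 ^ (n + 1) ∸ 1)
a-suc≡5*[2^[n+1]∸1] n = trans (cong a (+-comm 1 n)) (a≡5*[2^n∸1] (n + 1))

band-index-≤ : ∀ n m {k} → a n < k → k ≤ a (suc m) → n ≤ m
band-index-≤ n m an<k k≤am = ≤-pred (a-cancel-< {n} {suc m} (<-≤-trans an<k k≤am))

band-index-unique : ∀ n m {k} → a n < k → k ≤ a (suc n) → a m < k → k ≤ a (suc m) → n ≡ m
band-index-unique n m an<k k≤an am<k k≤am =
  ≤-antisym (band-index-≤ n m an<k k≤am) (band-index-≤ m n am<k k≤an)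

data SuspenseView : ℕ → Set where
  empty    : SuspenseView 0
  oddPart  : ∀ {k} n → a n < k → 2 + k ≤ a (suc n) → SuspenseView k
  evenPart : ∀ {k} n → a (suc n) ≤ suc k → k ≤ a (suc n) → SuspenseView k

viewValue : ∀ {k} → SuspenseView k → ℕ
viewValue empty = 0
viewValue (oddPart n _ _) = 1 + (n + n)
viewValue (evenPart n _ _) = 2 + (n + n)

view : ∀ k → SuspenseView k
view zero = empty
view (suc k) with view k
... | empty = oddPart 0 (s≤s z≤n) (s≤s (s≤s (s≤s z≤n)))
... | oddPart n an<k 2+k≤A with 3 + k ≤? a (suc n)
...   | yes 3+k≤A = oddPart n (m<n⇒m<1+n an<k) 3+k≤A
...   | no 3+k≰A = evenPart n (≤-pred (≰⇒> 3+k≰A)) (≤-trans (n≤1+n (suc k)) 2+k≤A)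
view (suc k) | evenPart n A≤1+k k≤A with m≤n⇒m<n∨m≡n k≤A
...   | inj₁ k<A = evenPart n (m≤n⇒m≤1+n A≤1+k) k<A
...   | inj₂ k≡A = oddPart (suc n) (s≤s (≤-reflexive (sym k≡A)))
                     (+-monoʳ-≤ 3 (≤-trans (≤-reflexive k≡A) (≤-trans (m≤m+n A A) (m≤n+m (A + A) 2))))
  where A = a (suc n)

evenPart-above : ∀ n {k} → a (suc n) ≤ suc k → a n < k
evenPart-above n A≤1+k =
  ≤-trans (m≤n+m (suc (a n)) 3) (+-cancelˡ-≤ 1 _ _ (≤-trans (+-monoʳ-≤ 5 (m≤m+n (a n) (a n))) A≤1+k))

odd∧evenPart⇒⊥ : ∀ n m {k} → a n < k → 2 + k ≤ a (suc n) →
                 a (suc m) ≤ suc k → k ≤ a (suc m) → ⊥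
odd∧evenPart⇒⊥ n m {k} an<k 2+k≤An Am≤1+k k≤Am
  with band-index-unique n m an<k (≤-trans (m≤n+m k 2) 2+k≤An) (evenPart-above m Am≤1+k) k≤Am
... | refl = 1+n≰n (≤-trans 2+k≤An Am≤1+k)

viewValue-unique : ∀ {k} (v w : SuspenseView k) → viewValue v ≡ viewValue w
viewValue-unique empty empty = refl
viewValue-unique empty (oddPart _ () _)
viewValue-unique empty (evenPart _ (s≤s ()) _)
viewValue-unique (oddPart _ () _) empty
viewValue-unique (evenPart _ (s≤s ()) _) empty
viewValue-unique {k} (oddPart n an<k 2+k≤An) (oddPart m am<k 2+k≤Am) =
  cong (λ i → 1 + (i + i))
    (band-index-unique n m an<k (≤-trans (m≤n+m k 2) 2+k≤An) am<k (≤-trans (m≤n+m k 2) 2+k≤Am))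
viewValue-unique (evenPart n An≤1+k k≤An) (evenPart m Am≤1+k k≤Am) =
  cong (λ i → 2 + (i + i))
    (band-index-unique n m (evenPart-above n An≤1+k) k≤An (evenPart-above m Am≤1+k) k≤Am)
viewValue-unique (oddPart n an<k 2+k≤An) (evenPart m Am≤1+k k≤Am) =
  ⊥-elim (odd∧evenPart⇒⊥ n m an<k 2+k≤An Am≤1+k k≤Am)
viewValue-unique (evenPart n An≤1+k k≤An) (oddPart m am<k 2+k≤Am) =
  ⊥-elim (odd∧evenPart⇒⊥ m n am<k 2+k≤Am An≤1+k k≤An)

suspense : ℕ → ℕ
suspense k = viewValue (view k)

suspense-view : ∀ {k} (v : SuspenseView k) → suspense k ≡ viewValue v
suspense-view {k} = viewValue-unique (view k)

viewValue-mono : ∀ {i j} (v : SuspenseView i) (w : SuspenseView j) → i ≤ j → viewValue v ≤ viewValue w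
viewValue-mono empty _ _ = z≤n
viewValue-mono (oddPart _ () _) empty z≤n
viewValue-mono (evenPart _ (s≤s ()) _) empty z≤n
viewValue-mono {j = j} (oddPart n an<i _) (oddPart m _ 2+j≤Am) i≤j =
  +-monoʳ-≤ 1 (double-mono (band-index-≤ n m (<-≤-trans an<i i≤j) (≤-trans (m≤n+m j 2) 2+j≤Am)))
viewValue-mono (oddPart n an<i _) (evenPart m _ j≤Am) i≤j =
  m≤n⇒m≤1+n (+-monoʳ-≤ 1 (double-mono (band-index-≤ n m (<-≤-trans an<i i≤j) j≤Am)))
viewValue-mono (evenPart n An≤1+i _) (evenPart m _ j≤Am) i≤j =
  +-monoʳ-≤ 2 (double-mono (band-index-≤ n m (<-≤-trans (evenPart-above n An≤1+i) i≤j) j≤Am))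
viewValue-mono (evenPart n An≤1+i _) (oddPart m _ 2+j≤Am) i≤j =
  s≤s (+-mono-≤ n<m (<⇒≤ n<m))
  where
  n<m : n < m
  n<m = ≤-pred (a-cancel-< {suc n} {suc m} (≤-trans (s≤s (≤-trans An≤1+i (s≤s i≤j))) 2+j≤Am))

suspense-mono : ∀ {i j} → i ≤ j → suspense i ≤ suspense j
suspense-mono {i} {j} = viewValue-mono (view i) (view j)

evenPart-options : ∀ n {k r} → a (suc n) ≤ suc k → k ≤ a (suc n) → NKMove k r →
                   maxBy suspense r ≡ 1 + (n + n)
evenPart-options n {k} A≤1+k k≤A move with nk-largest-part move (≤-pred (≤-trans (5≤a-suc n) A≤1+k))
... | j , j∈r , largest , k≤3+2j , 2+j≤k =
  trans (maxBy-largest suspense suspense-mono j∈r largest) (suspense-view (oddPart n an<j (≤-trans 2+j≤k k≤A)))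
  where
  an<j : a n < j
  an<j = half-< (+-cancelˡ-≤ 4 _ _ (≤-trans A≤1+k (s≤s k≤3+2j)))

even-option-view : ∀ {k r} (v : SuspenseView k) → even (viewValue v) ≡ true → NKMove k r →
                   suc (maxBy suspense r) ≡ viewValue v
even-option-view empty _ ()
even-option-view (oddPart n _ _) even-odd _ = ⊥-elim (false≢true (trans (sym (even-suc-double n)) even-odd))
even-option-view (evenPart n A≤1+k k≤A) _ move = cong suc (evenPart-options n A≤1+k k≤A move)

suspense-even-option : ∀ {k r} → even (suspense k) ≡ true → NKMove k r → suc (maxBy suspense r) ≡ suspense k
suspense-even-option {k} = even-option-view (view k)

-- The reply keeps a component of length a (suc n), or k + 2 if that is shorter;
-- either way it lies in the even part of band n.
oddPart-reply : ∀ n k → a (suc n) < 4 + k → 6 + k ≤ a (2 + n) →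
                ∃[ r ] NKMove (4 + k) r × maxBy suspense r ≡ 2 + (n + n)
oddPart-reply n k A<4+k 6+k≤ with 2 + k ≤? a (suc n)
... | yes 2+k≤A = _ , end2 k , trans (⊔-identityʳ (suspense (2 + k)))
                     (suspense-view (evenPart n (≤-pred A<4+k) 2+k≤A))
... | no 2+k≰A with m≤n⇒m<n∨m≡n (≤-pred (≰⇒> 2+k≰A))
...   | inj₂ A≡1+k = _ , end3 k , trans (⊔-identityʳ (suspense (1 + k)))
                       (suspense-view (evenPart n (m≤n⇒m≤1+n (≤-reflexive A≡1+k)) (≤-reflexive (sym A≡1+k))))
...   | inj₁ A<1+k = _ , split k (1 + k ∸ A) A (m<n⇒0<n∸m A<1+k) rest≤A (m∸n+n≡m (<⇒≤ A<1+k)) ,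
                     trans (maxBy-largest suspense suspense-mono (there (here refl)) largest)
                           (suspense-view (evenPart n (n≤1+n A) ≤-refl))
  where
  A = a (suc n)
  rest≤A : 1 + k ∸ A ≤ A
  rest≤A = ≤-trans (∸-monoˡ-≤ A (+-cancelˡ-≤ 5 _ _ 6+k≤)) (≤-reflexive (m+n∸n≡m A A))
  largest : ∀ {i} → i ∈ (1 + k ∸ A ∷ A ∷ []) → i ≤ A
  largest (here refl) = rest≤A
  largest (there (here refl)) = ≤-refl

pred-option-view : ∀ {k} (v : SuspenseView (suc k)) →
                   ∃[ r ] NKMove (suc k) r × suc (maxBy suspense r) ≡ viewValue v
pred-option-view {k} (evenPart n A≤1+k k≤A) with nk-some-move k
... | r , move = r , move , even-option-view (evenPart n A≤1+k k≤A) (even-2+double n) move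
pred-option-view {zero} (oddPart zero _ _) = _ , one , refl
pred-option-view {1} (oddPart zero _ _) = _ , two , refl
pred-option-view {2} (oddPart zero _ _) = _ , three0 , refl
pred-option-view {suc (suc (suc k))} (oddPart zero _ (s≤s (s≤s (s≤s (s≤s (s≤s ()))))))
pred-option-view {zero} (oddPart (suc n) (s≤s ()) _)
pred-option-view {1} (oddPart (suc n) (s≤s (s≤s ())) _)
pred-option-view {2} (oddPart (suc n) (s≤s (s≤s (s≤s ()))) _)
pred-option-view {suc (suc (suc k))} (oddPart (suc n) A<4+k 6+k≤) with oddPart-reply n k A<4+k 6+k≤
... | r , move , max≡ = r , move , cong suc (trans max≡ (cong suc (sym (+-suc n n))))

suspense-pred-option : ∀ k → ∃[ r ] NKMove (suc k) r × suc (maxBy suspense r) ≡ suspense (suc k)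
suspense-pred-option k = pred-option-view (view (suc k))

evenPart-even : ∀ n {k} → a (suc n) ≤ suc k → k ≤ a (suc n) → even (suspense k) ≡ true
evenPart-even n A≤1+k k≤A = trans (cong even (suspense-view (evenPart n A≤1+k k≤A))) (even-2+double n)

even-suspense⇔InL : ∀ m → (even (suspense m) ≡ true) ⇔ InL m
even-suspense⇔InL m = mk⇔ (to (view m)) from
  where
  to : (v : SuspenseView m) → even (viewValue v) ≡ true → InL m
  to empty _ = inj₁ (0 , refl)
  to (oddPart n _ _) even-odd = ⊥-elim (false≢true (trans (sym (even-suc-double n)) even-odd))
  to (evenPart n A≤1+m m≤A) _ with m≤n⇒m<n∨m≡n m≤A
  ... | inj₂ m≡A = inj₁ (suc n , trans m≡A (a≡5*[2^n∸1] (suc n)))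
  ... | inj₁ m<A = inj₂ (n , cong (_∸ 1) (trans (≤-antisym m<A A≤1+m) (a-suc≡5*[2^[n+1]∸1] n)))

  from : InL m → even (suspense m) ≡ true
  from (inj₁ (zero , refl)) = refl
  from (inj₁ (suc n , refl)) =
    subst (λ x → even (suspense x) ≡ true) (a≡5*[2^n∸1] (suc n)) (evenPart-even n (n≤1+n _) ≤-refl)
  from (inj₂ (n , refl)) =
    subst (λ x → even (suspense x) ≡ true) (cong (_∸ 1) (a-suc≡5*[2^[n+1]∸1] n))
      (evenPart-even n ≤-refl (n≤1+n _))

corollary4 : ∀ (m : ℕ) → IsP (m ∷ []) ⇔ InL m
corollary4 m = ⇔-trans (isP⇔even-maxBy (m ∷ []))
  (subst (λ x → (even x ≡ true) ⇔ InL m) (sym (⊔-identityʳ (suspense m))) (even-suspense⇔InL m))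
  where
  open MaxSuspense suspense refl (maxBy-option-≤ suspense suspense-mono)
                   suspense-even-option suspense-pred-option
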